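{- Let $r$ and $N$ be positive integers such that $N\geq 3^{r^2+r}$. Then if $\{1,\ldots,N\}=A_1\cup\cdots\cup A_r$ is a partition of $\{1,\ldots,N\}$, we have \[\max\{R_2(A_i):1\leq i\leq r\}\geq \frac{N^{1/r}}{3^r}.\]
   Context: For $L\geq 1$, a finite increasing sequence of real numbers $a_1<\cdots<a_n$ (equivalently, a finite set of reals listed in increasing order) is called $L$-regular if there is a positive real number $X$ such that $X\leq a_{i+1}-a_i\leq LX$ for all $i=1,\ldots,n-1$. For a set $A$ of real numbers, $R_L(A)=\max\{|A'|:A'\subseteq A,\ A'\text{ is }L\text{ -regular}\}$. -}

module Defs where

open import Data.Nat using (ℕ; _+_; _*_; _∸_; _≤_; _<_)
open import Data.List using (List; []; _∷_; length)
open import Data.List.Relation.Unary.All using (All)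
open import Data.List.Relation.Unary.Linked using (Linked)
open import Data.Product using (Σ; _×_)

diffs : List ℕ → List ℕ
diffs (x ∷ y ∷ xs) = (y ∸ x) ∷ diffs (y ∷ xs)
diffs _ = []

-- L-regular (for integer L ≥ 1, sequences of naturals): strictly increasing
-- and there is X > 0 with X ≤ a_{i+1} - a_i ≤ L X for all i.
-- (X ranges over ℕ; for integer sequences this is equivalent to X real,
--  since X = min gap works whenever any real X does.)
Regular : ℕ → List ℕ → Set
Regular L xs = Linked _<_ xs × Σ ℕ (λ X → 1 ≤ X × All (λ d → X ≤ d × d ≤ L * X) (diffs xs))

RegularSubsetOf : ℕ → (ℕ → Set) → List ℕ → Set
RegularSubsetOf L A xs = All A xs × Regular L xs

-- Induction on the number r of colours, for an interval of length n ≥ (2m)^r: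
-- with L = (2m)^(r-1), scan for a point of the last colour among the first L
-- positions and then, greedily, for the next one in the window (a + L, a + 2L]
-- after the previous point a. Either m points are found, with gaps in [L, 2L],
-- or some window of length L misses that colour and the induction hypothesis
-- applies to it. For the theorem take the largest m with (2m)^r ≤ N; then
-- N < (2(m+1))^r ≤ (3^r m)^r.
module Submission where

open import Data.Nat using (ℕ; _+_; _*_; _^_; _≤_)
open import Data.Fin using (Fin)
open import Data.List using (List; length)
open import Data.Product using (Σ; _×_)
open import Relation.Binary.PropositionalEquality using (_≡_)
open import Defs

open import Data.Nat using (zero; suc; _<_; _∸_; z≤n; s≤s; s≤s⁻¹; _≟_; _≤?_; anyUpTo?; NonZero)
open import Data.Nat.Properties
open import Data.Nat.Tactic.RingSolver using (solve-∀)
open import Data.Fin using (toℕ)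
open import Data.Fin.Properties using (toℕ<n; toℕ-injective)
open import Data.List using ([]; _∷_)
open import Data.List.Relation.Unary.All as All using (All; []; _∷_)
open import Data.List.Relation.Unary.Linked using (Linked; [-]; _∷_)
open import Data.Product as Product using (_,_; ∃)
open import Data.Sum as Sum using (_⊎_; inj₁; inj₂)
open import Data.Empty using (⊥-elim)
open import Function using (_∘_)
open import Relation.Nullary using (¬_; yes; no; contradiction)
open import Relation.Unary using (Decidable)
open import Relation.Binary.PropositionalEquality using (refl; sym; trans; cong; subst; _≢_)

largest-satisfying : {P : ℕ → Set} → Decidable P → ∀ d k → P k → ¬ P (k + d) →
                     ∃ λ m → k ≤ m × P m × ¬ P (suc m)
largest-satisfying {P} P? zero k Pk ¬Pk+0 = ⊥-elim (¬Pk+0 (subst P (sym (+-identityʳ k)) Pk))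
largest-satisfying {P} P? (suc d) k Pk ¬Pk+d+1 with P? (suc k)
... | no ¬Pk+1 = k , ≤-refl , Pk , ¬Pk+1
... | yes Pk+1 with largest-satisfying P? d (suc k) Pk+1 (subst (¬_ ∘ P) (+-suc k d) ¬Pk+d+1)
...   | m , k<m , Pm , ¬Pm+1 = m , <⇒≤ k<m , Pm , ¬Pm+1

InWindow : ℕ → ℕ → ℕ → Set
InWindow s n a = s < a × a ≤ s + n

InWindow-mono : ∀ {s n t L a} → s ≤ t → t + L ≤ s + n → InWindow t L a → InWindow s n a
InWindow-mono s≤t t+L≤s+n (t<a , a≤t+L) = ≤-<-trans s≤t t<a , ≤-trans a≤t+L t+L≤s+n

window-offset : ∀ {t L b} → InWindow t L b → ∃ λ x → x < L × suc (t + x) ≡ b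
window-offset {t} {L} {b} (t<b , b≤t+L) =
  b ∸ suc t , +-cancelˡ-< t _ L (subst (_≤ t + L) (sym 1+t+x≡b) b≤t+L) , 1+t+x≡b
  where
  1+t+x≡b : suc (t + (b ∸ suc t)) ≡ b
  1+t+x≡b = m+[n∸m]≡n t<b

search-window : {P : ℕ → Set} → Decidable P → ∀ t L →
                (∃ λ b → InWindow t L b × P b) ⊎ (∀ b → InWindow t L b → ¬ P b)
search-window {P} P? t L with anyUpTo? (P? ∘ suc ∘ (t +_)) L
... | yes (x , x<L , P[1+t+x]) = inj₁ (suc (t + x) , (s≤s (m≤m+n t x) , +-monoʳ-< t x<L) , P[1+t+x])
... | no none = inj₂ λ b b∈ Pb →
  let x , x<L , 1+t+x≡b = window-offset b∈ in none (x , x<L , subst P (sym 1+t+x≡b) Pb)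

a+[1+c]*2L≡a+L+L+c*2L : ∀ a L c → a + suc c * (2 * L) ≡ a + L + L + c * (2 * L)
a+[1+c]*2L≡a+L+L+c*2L = solve-∀

a+L+L≡a+2L : ∀ a L → a + L + L ≡ a + 2 * L
a+L+L≡a+2L = solve-∀

2[1+m]*L≡L+m*2L+L : ∀ m' L → 2 * suc m' * L ≡ L + m' * (2 * L) + L
2[1+m]*L≡L+m*2L+L = solve-∀

GapsBetween : ℕ → List ℕ → Set
GapsBetween L xs = All (λ g → L ≤ g × g ≤ 2 * L) (diffs xs)

module _ (colour : ℕ → ℕ) where

  Coloured : ℕ → ℕ → ℕ → ℕ → Set
  Coloured s n j a = InWindow s n a × colour a ≡ j

  Avoids : ℕ → ℕ → ℕ → Set
  Avoids j t L = ∀ b → InWindow t L b → colour b ≢ j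

  AvoidingWindow : ℕ → ℕ → ℕ → ℕ → Set
  AvoidingWindow s n j L = ∃ λ t → s ≤ t × t + L ≤ s + n × Avoids j t L

  Chain : ℕ → ℕ → ℕ → ℕ → List ℕ → Set
  Chain s n j L xs = All (Coloured s n j) xs × Linked _<_ xs × GapsBetween L xs

  MonochromaticRegular : ℕ → ℕ → ℕ → Set
  MonochromaticRegular s n m =
    ∃ λ j → Σ (List ℕ) λ xs → All (Coloured s n j) xs × Regular 2 xs × length xs ≡ m

  chain-or-avoiding-window : ∀ {s n j} L c a → s < a → a + c * (2 * L) ≤ s + n → colour a ≡ j →
    (Σ (List ℕ) λ ys → length ys ≡ c × Chain s n j L (a ∷ ys)) ⊎ AvoidingWindow s n j L
  chain-or-avoiding-window L zero a s<a a≤s+n ca =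
    inj₁ ([] , refl , ((s<a , subst (_≤ _) (+-identityʳ a) a≤s+n) , ca) ∷ [] , [-] , [])
  chain-or-avoiding-window {s} {n} {j} L (suc c) a s<a bound ca
    with search-window (λ b → colour b ≟ j) (a + L) L
  ... | inj₂ avoid = inj₂ (a + L , ≤-trans (<⇒≤ s<a) (m≤m+n a L) , ≤-trans (m≤m+n _ _) bound′ , avoid)
    where
    bound′ : a + L + L + c * (2 * L) ≤ s + n
    bound′ = subst (_≤ s + n) (a+[1+c]*2L≡a+L+L+c*2L a L c) bound
  ... | inj₁ (b , (a+L<b , b≤a+L+L) , cb) =
    Sum.map₁ extend (chain-or-avoiding-window L c b (<-trans s<a a<b) bound′ cb)
    where
    a<b : a < b
    a<b = ≤-<-trans (m≤m+n a L) a+L<b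
    bound′ : b + c * (2 * L) ≤ s + n
    bound′ = ≤-trans (+-monoˡ-≤ _ b≤a+L+L) (subst (_≤ s + n) (a+[1+c]*2L≡a+L+L+c*2L a L c) bound)
    L≤gap : L ≤ b ∸ a
    L≤gap = m+n≤o⇒m≤o∸n L (subst (_≤ b) (+-comm a L) (<⇒≤ a+L<b))
    gap≤2L : b ∸ a ≤ 2 * L
    gap≤2L = m≤n+o⇒m∸n≤o b a (subst (b ≤_) (a+L+L≡a+2L a L) b≤a+L+L)
    extend : (Σ (List ℕ) λ ys → length ys ≡ c × Chain s n j L (b ∷ ys)) →
             (Σ (List ℕ) λ ys → length ys ≡ suc c × Chain s n j L (a ∷ ys))
    extend (ys , len , coloured , linked , gaps) =
      b ∷ ys , cong suc len ,
      ((s<a , ≤-trans (m≤m+n a _) bound) , ca) ∷ coloured , a<b ∷ linked , (L≤gap , gap≤2L) ∷ gaps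

  MonochromaticRegular-mono : ∀ {s n t L m} → s ≤ t → t + L ≤ s + n →
                              MonochromaticRegular t L m → MonochromaticRegular s n m
  MonochromaticRegular-mono s≤t t+L≤s+n (j , xs , coloured , regular , len) =
    j , xs , All.map (Product.map₁ (InWindow-mono s≤t t+L≤s+n)) coloured , regular , len

  monochromatic-regular : ∀ k s n m → 1 ≤ m → (2 * m) ^ k ≤ n →
    (∀ a → InWindow s n a → colour a < k) → MonochromaticRegular s n m
  monochromatic-regular zero s n m _ 1≤n bounded = ⊥-elim (n≮0 (bounded (suc s) (n<1+n s , s<s+n)))
    where
    s<s+n : s < s + n
    s<s+n = m<m+n s 1≤n
  monochromatic-regular (suc k) s n m@(suc m') 1≤m 2mL≤n bounded =
    Sum.[ from-first , below s ≤-refl (+-monoʳ-≤ s L≤n) ] (search-window (λ b → colour b ≟ k) s L)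
    where
    L : ℕ
    L = (2 * m) ^ k
    L≤n : L ≤ n
    L≤n = ≤-trans (m≤n*m L (2 * m)) 2mL≤n
    below : ∀ t → s ≤ t → t + L ≤ s + n → Avoids k t L → MonochromaticRegular s n m
    below t s≤t t+L≤s+n avoid =
      MonochromaticRegular-mono s≤t t+L≤s+n (monochromatic-regular k t L m 1≤m ≤-refl bounded′)
      where
      bounded′ : ∀ a → InWindow t L a → colour a < k
      bounded′ a a∈ = ≤∧≢⇒< (s≤s⁻¹ (bounded a (InWindow-mono s≤t t+L≤s+n a∈))) (avoid a a∈)
    from-first : (∃ λ a → InWindow s L a × colour a ≡ k) → MonochromaticRegular s n m
    from-first (a , (s<a , a≤s+L) , ca) =
      Sum.[ regular , (λ (t , s≤t , t+L≤s+n , avoid) → below t s≤t t+L≤s+n avoid) ]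
        (chain-or-avoiding-window L m' a s<a bound ca)
      where
      bound : a + m' * (2 * L) ≤ s + n
      bound = begin
        a + m' * (2 * L)       ≤⟨ +-monoˡ-≤ _ a≤s+L ⟩
        s + L + m' * (2 * L)   ≡⟨ +-assoc s L _ ⟩
        s + (L + m' * (2 * L)) ≤⟨ +-monoʳ-≤ s (m≤m+n _ L) ⟩
        s + (L + m' * (2 * L) + L) ≡⟨ cong (s +_) (sym (2[1+m]*L≡L+m*2L+L m' L)) ⟩
        s + 2 * m * L          ≤⟨ +-monoʳ-≤ s 2mL≤n ⟩
        s + n                  ∎
        where open ≤-Reasoning
      regular : (Σ (List ℕ) λ ys → length ys ≡ m' × Chain s n k L (a ∷ ys)) → MonochromaticRegular s n m
      regular (ys , len , coloured , linked , gaps) =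
        k , a ∷ ys , coloured , (linked , L , m^n>0 (2 * m) k , gaps) , cong suc len

colour-class : ∀ {r N} (c : ℕ → Fin r) {j x xs} → All (Coloured (toℕ ∘ c) 0 N j) (x ∷ xs) →
               All (λ a → 1 ≤ a × a ≤ N × c a ≡ c x) (x ∷ xs)
colour-class c coloured@((_ , cx) ∷ _) =
  All.map (λ ((0<a , a≤N) , ca) → 0<a , a≤N , toℕ-injective (trans ca (sym cx))) coloured

m≤m^[1+n] : ∀ m n .{{_ : NonZero m}} → m ≤ m ^ suc n
m≤m^[1+n] m n = m≤m*n m (m ^ n) {{m^n≢0 m n}}

4^r≤3^[r*r+r] : ∀ r .{{_ : NonZero r}} → 4 ^ r ≤ 3 ^ (r * r + r)
4^r≤3^[r*r+r] r = begin
  4 ^ r         ≤⟨ ^-monoˡ-≤ r (+-monoʳ-≤ 4 (z≤n {5})) ⟩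
  (3 ^ 2) ^ r   ≡⟨ ^-*-assoc 3 2 r ⟩
  3 ^ (2 * r)   ≤⟨ ^-monoʳ-≤ 3 (+-mono-≤ (m≤m*n r r) (≤-reflexive (+-identityʳ r))) ⟩
  3 ^ (r * r + r) ∎
  where open ≤-Reasoning

2[1+m]≤3^r*m : ∀ r {m} .{{_ : NonZero r}} → 2 ≤ m → 2 * suc m ≤ 3 ^ r * m
2[1+m]≤3^r*m r@(suc _) {m} 2≤m = begin
  2 * suc m   ≡⟨ *-suc 2 m ⟩
  2 + 2 * m   ≤⟨ +-monoˡ-≤ (2 * m) 2≤m ⟩
  m + 2 * m   ≡⟨⟩
  3 * m       ≤⟨ *-monoˡ-≤ m (^-monoʳ-≤ 3 {1} {r} (s≤s z≤n)) ⟩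
  3 ^ r * m   ∎
  where open ≤-Reasoning

theorem1 : (r N : ℕ) → 1 ≤ r → 1 ≤ N → 3 ^ (r * r + r) ≤ N → (c : ℕ → Fin r) →
    Σ (Fin r) (λ i → Σ (List ℕ) (λ xs →
    RegularSubsetOf 2 (λ a → 1 ≤ a × a ≤ N × c a ≡ i) xs × N ≤ (3 ^ r * length xs) ^ r))
theorem1 r@(suc r') N _ _ 3^[r*r+r]≤N c
  with largest-satisfying (λ m → (2 * m) ^ r ≤? N) N 2 4^r≤N (<⇒≱ N<[4+2N]^r)
  where
  4^r≤N : 4 ^ r ≤ N
  4^r≤N = ≤-trans (4^r≤3^[r*r+r] r) 3^[r*r+r]≤N
  N<[4+2N]^r : N < (2 * (2 + N)) ^ r
  N<[4+2N]^r = ≤-trans (m≤n+m (suc N) 1) (≤-trans (m≤n*m (2 + N) 2) (m≤m^[1+n] (2 * (2 + N)) r'))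
... | m , 2≤m , fits , too-big
  with monochromatic-regular (toℕ ∘ c) r 0 N m (<⇒≤ 2≤m) fits (λ a _ → toℕ<n (c a))
... | _ , [] , _ , _ , refl = contradiction 2≤m λ ()
... | _ , x ∷ xs , coloured , regular , refl =
  c x , x ∷ xs , (colour-class c coloured , regular) ,
  ≤-trans (<⇒≤ (≰⇒> too-big)) (^-monoˡ-≤ r (2[1+m]≤3^r*m r 2≤m))
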